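{- For every $n$, the set of under-indecomposable relations of size $n$ is an upper ideal of the weak order on $\mathrm{IRel}_n$: if $R\in\mathrm{IRel}_n$ is under-indecomposable and $R\le S$, then $S$ is under-indecomposable.
   Context: For $n \ge 0$ let $[n]=\{1,\dots,n\}$. An integer relation of size $n$ is a reflexive binary relation $R \subseteq [n]^2$; $\mathrm{IRel}_n$ is the set of these; $|R|$ is the size. Write $\mathrm{Inc}(R)=\{(a,b)\in R: a\le b\}$, $\mathrm{Dec}(R)=\{(b,a)\in R : a\le b\}$; the weak order on $\mathrm{IRel}_n$ is $R\le S$ iff $\mathrm{Inc}(R)\supseteq\mathrm{Inc}(S)$ and $\mathrm{Dec}(R)\subseteq\mathrm{Dec}(S)$. For $S\in\mathrm{IRel}_n$, $m\ge0$: $\overline{S}=\{(m+i,m+j):(i,j)\in S\}$, $\overline{[n]}=\{m+1,\dots,m+n\}$, and for $R\in\mathrm{IRel}_m$, $\mathrm{U}(R,S)=R\cup\overline{S}\cup([m]\times\overline{[n]})$. A relation $T$ is under-indecomposable if there are no $R,S$ with $|R|\ge1$, $|S|\ge1$ and $T=\mathrm{U}(R,S)$. -}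

module Defs where

open import Data.Nat using (ℕ; suc; _+_; _≤_)
open import Data.Fin using (Fin; toℕ; splitAt; cast)
open import Data.Bool using (Bool; true; false; _∧_; _∨_)
open import Data.Empty using (⊥)
open import Data.Sum using (_⊎_; inj₁; inj₂)
open import Data.Product using (Σ; _×_; ∃-syntax)
open import Relation.Binary.PropositionalEquality using (_≡_)

-- A binary relation on [n] = Fin n (element i : Fin n stands for toℕ i + 1),
-- given by its (decidable) characteristic function.
Rel : ℕ → Set
Rel n = Fin n → Fin n → Bool

record IRel (n : ℕ) : Set where
  constructor mkIRel
  field
    rel    : Rel n
    reflex : ∀ i → rel i i ≡ true
open IRel public

_∋_,_ : ∀ {n} → IRel n → Fin n → Fin n → Set
R ∋ a , b = rel R a b ≡ true

-- Weak order: Inc(R) ⊇ Inc(S) and Dec(R) ⊆ Dec(S).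
-- Inc(R) = {(a,b) ∈ R : a ≤ b},  Dec(R) = {(b,a) ∈ R : a ≤ b}.
_≤W_ : ∀ {n} → IRel n → IRel n → Set
_≤W_ {n} R S =
  (∀ (a b : Fin n) → toℕ a ≤ toℕ b → S ∋ a , b → R ∋ a , b)
  × (∀ (a b : Fin n) → toℕ a ≤ toℕ b → R ∋ b , a → S ∋ b , a)

-- U(R,S) = R ∪ S̄ ∪ ([m] × [n]̄) as a relation on [m+n]
-- (splitAt m sends the first m elements to inj₁, the shifted ones to inj₂).
Urel : ∀ {m n} → Rel m → Rel n → Rel (m + n)
Urel {m} R S i j with splitAt m i | splitAt m j
... | inj₁ a | inj₁ b = R a b
... | inj₂ a | inj₂ b = S a b
... | inj₁ a | inj₂ b = true
... | inj₂ a | inj₁ b = false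

IsUnder : ∀ {k m n} → IRel k → IRel m → IRel n → Set
IsUnder {k} {m} {n} T R S =
  Σ (m + n ≡ k) λ e →
    ∀ (i j : Fin (m + n)) → rel T (cast e i) (cast e j) ≡ Urel (rel R) (rel S) i j

UnderIndecomposable : ∀ {k} → IRel k → Set
UnderIndecomposable {k} T =
  ∀ (m n : ℕ) → 1 ≤ m → 1 ≤ n → (R : IRel m) (S : IRel n) → IsUnder T R S → ⊥

-- Fix a size k and a splitting e : m + n ≡ k of [k] into a lower block (the
-- first m elements) and an upper block (the last n).  Call T split at e when
-- T contains every pair (lower, upper) and no pair (upper, lower).  The proof
-- rests on three facts:
--   * T = U(A, B) along e for some A, B  ⇒  T is split at e;
--   * T split at e  ⇒  T = U(T|lower, T|upper) along e (its two restrictions);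
--   * splitting is inherited downwards in the weak order: a cross pair
--     (lower, upper) is increasing, and R ≤ S keeps increasing pairs of S in R;
--     a cross pair (upper, lower) is decreasing, and R ≤ S sends decreasing
--     pairs of R into S.
-- Hence a decomposition S = U(A, B) with R ≤ S yields the decomposition
-- R = U(R|lower, R|upper) with blocks of the same sizes, contradicting the
-- under-indecomposability of R.
module Submission where

open import Defs
open import Data.Nat using (ℕ; _<_; _+_)
open import Data.Nat.Properties using (<⇒≤; <-≤-trans; m≤m+n)
open import Data.Fin using (Fin; toℕ; splitAt; join; cast; _↑ˡ_; _↑ʳ_)
open import Data.Fin.Properties
  using (toℕ-↑ˡ; toℕ-↑ʳ; toℕ<n; toℕ-cast; splitAt-↑ˡ; splitAt-↑ʳ; join-splitAt)
open import Data.Bool using (Bool; true; false)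
open import Data.Bool.Properties using (¬-not)
open import Data.Empty using (⊥)
open import Data.Sum using (_⊎_; inj₁; inj₂)
open import Data.Product using (_×_; _,_)
open import Relation.Binary.PropositionalEquality using (_≡_; refl; sym; trans; subst)

fin-+-elim : ∀ {m n} (P : Fin (m + n) → Set) →
             (∀ a → P (a ↑ˡ n)) → (∀ b → P (m ↑ʳ b)) → ∀ i → P i
fin-+-elim {m} {n} P lower upper i = subst P (join-splitAt m n i) (onSum (splitAt m i))
  where
  onSum : (x : Fin m ⊎ Fin n) → P (join m n x)
  onSum (inj₁ a) = lower a
  onSum (inj₂ b) = upper b

module _ {m n : ℕ} (R : Rel m) (S : Rel n) where

  Urel-lower-lower : ∀ a b → Urel R S (a ↑ˡ n) (b ↑ˡ n) ≡ R a b
  Urel-lower-lower a b rewrite splitAt-↑ˡ m a n | splitAt-↑ˡ m b n = refl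

  Urel-upper-upper : ∀ a b → Urel R S (m ↑ʳ a) (m ↑ʳ b) ≡ S a b
  Urel-upper-upper a b rewrite splitAt-↑ʳ m n a | splitAt-↑ʳ m n b = refl

  Urel-lower-upper : ∀ a b → Urel R S (a ↑ˡ n) (m ↑ʳ b) ≡ true
  Urel-lower-upper a b rewrite splitAt-↑ˡ m a n | splitAt-↑ʳ m n b = refl

  Urel-upper-lower : ∀ b a → Urel R S (m ↑ʳ b) (a ↑ˡ n) ≡ false
  Urel-upper-lower b a rewrite splitAt-↑ʳ m n b | splitAt-↑ˡ m a n = refl

module _ {k m n : ℕ} (e : m + n ≡ k) where

  lower : Fin m → Fin k
  lower a = cast e (a ↑ˡ n)

  upper : Fin n → Fin k
  upper b = cast e (m ↑ʳ b)

  lower<upper : ∀ a b → toℕ (lower a) < toℕ (upper b)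
  lower<upper a b
    rewrite toℕ-cast e (a ↑ˡ n) | toℕ-cast e (m ↑ʳ b) | toℕ-↑ˡ a n | toℕ-↑ʳ m b
    = <-≤-trans (toℕ<n a) (m≤m+n m (toℕ b))

  restrictLower : IRel k → IRel m
  restrictLower T = mkIRel (λ a b → rel T (lower a) (lower b)) (λ a → reflex T (lower a))

  restrictUpper : IRel k → IRel n
  restrictUpper T = mkIRel (λ a b → rel T (upper a) (upper b)) (λ a → reflex T (upper a))

  SplitAt : IRel k → Set
  SplitAt T = (∀ a b → T ∋ lower a , upper b) × (∀ b a → rel T (upper b) (lower a) ≡ false)

  split-of-under : ∀ {T : IRel k} {A : IRel m} {B : IRel n} →
                   (∀ i j → rel T (cast e i) (cast e j) ≡ Urel (rel A) (rel B) i j) →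
                   SplitAt T
  split-of-under {A = A} {B} h =
      (λ a b → trans (h (a ↑ˡ n) (m ↑ʳ b)) (Urel-lower-upper (rel A) (rel B) a b))
    , (λ b a → trans (h (m ↑ʳ b) (a ↑ˡ n)) (Urel-upper-lower (rel A) (rel B) b a))

  under-of-split : ∀ (T : IRel k) → SplitAt T → IsUnder T (restrictLower T) (restrictUpper T)
  under-of-split T (lower-upper , upper-lower) = e , λ i j →
    fin-+-elim (λ i → ∀ j → rel T (cast e i) (cast e j) ≡ Urel RL RU i j)
      (λ a → fin-+-elim _ (λ b → sym (Urel-lower-lower RL RU a b))
                          (λ b → trans (lower-upper a b) (sym (Urel-lower-upper RL RU a b))))
      (λ b → fin-+-elim _ (λ a → trans (upper-lower b a) (sym (Urel-upper-lower RL RU b a)))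
                          (λ a → sym (Urel-upper-upper RL RU b a)))
      i j
    where
    RL = rel (restrictLower T)
    RU = rel (restrictUpper T)

  split-antitone : ∀ {R S : IRel k} → R ≤W S → SplitAt S → SplitAt R
  split-antitone (inc , dec) (lower-upper , upper-lower) =
      (λ a b → inc (lower a) (upper b) (<⇒≤ (lower<upper a b)) (lower-upper a b))
    , (λ b a → ¬-not λ inR → absurd (dec (lower a) (upper b) (<⇒≤ (lower<upper a b)) inR)
                                    (upper-lower b a))
    where
    absurd : ∀ {x : Bool} → x ≡ true → x ≡ false → ⊥
    absurd refl ()

mainTheorem8 : ∀ (n : ℕ) (R S : IRel n) → UnderIndecomposable R → R ≤W S → UnderIndecomposable S
mainTheorem8 k R S R-indec R≤S m n 1≤m 1≤n A B (e , S≡UAB) =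
  R-indec m n 1≤m 1≤n (restrictLower e R) (restrictUpper e R)
    (under-of-split e R (split-antitone e {R} {S} R≤S (split-of-under e {S} {A} {B} S≡UAB)))
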